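{- Let $(u,v)$ be an alphabet and $\theta\in\{u,v\}$ with $\theta\notin\{a,b\}$. If $(\alpha,\beta)$ is an alphabet such that, for some positive integer $s$ with $|\theta^s|>2\max\{|\alpha|,|\beta|\}$, the word $\theta^s$ is a subword of some word written in the alphabet $\{\alpha,\beta\}$ (i.e. of some finite concatenation of copies of $\alpha$ and $\beta$), then $\theta\in\{\alpha,\beta\}$ or $(u,v)$ is a child of $(\alpha,\beta)$.
   Context: Let $a=22$ and $b=11$ (words over $\{1,2\}$). For a pair of words $(u,v)$ define $\overline U(u,v)=(uv,v)$ and $\overline V(u,v)=(u,uv)$. The tree of alphabets is obtained from the root $(a,b)$ by successively applying $\overline U$ and $\overline V$; its vertices are called alphabets. An alphabet $(u,v)$ is a child of $(\alpha,\beta)$ if it is obtained from $(\alpha,\beta)$ by applying $\overline U$ or $\overline V$ successively finitely many times. A subword is a contiguous factor, $|w|$ is the length of a word $w$, and $\theta^s$ is the concatenation of $s$ copies of $\theta$. -}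

module Defs where

open import Data.Nat using (ℕ; zero; suc; _*_; _<_; _⊔_)
open import Data.List using (List; []; _∷_; _++_; length; concat; map)
open import Data.Product using (_×_; _,_; ∃; ∃-syntax)
open import Data.Bool using (Bool; true; false; if_then_else_)
open import Relation.Binary.PropositionalEquality using (_≡_)

data Letter : Set where
  l1 l2 : Letter

Word : Set
Word = List Letter

a : Word
a = l2 ∷ l2 ∷ []

b : Word
b = l1 ∷ l1 ∷ []

Pair : Set
Pair = Word × Word

Ubar : Pair → Pair
Ubar (u , v) = (u ++ v , v)

Vbar : Pair → Pair
Vbar (u , v) = (u , u ++ v)

data ChildOf (p : Pair) : Pair → Set where
  here  : ChildOf p p
  stepU : ∀ {q} → ChildOf p q → ChildOf p (Ubar q)
  stepV : ∀ {q} → ChildOf p q → ChildOf p (Vbar q)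

IsAlphabet : Pair → Set
IsAlphabet q = ChildOf (a , b) q

pow : Word → ℕ → Word
pow θ zero    = []
pow θ (suc s) = θ ++ pow θ s

Subword : Word → Word → Set
Subword x w = ∃[ p ] ∃[ q ] (p ++ x ++ q ≡ w)

wordOver : Word → Word → List Bool → Word
wordOver α β cs = concat (map (λ c → if c then α else β) cs)

-- Every alphabet is the image under the doubling morphism 1 ↦ 11, 2 ↦ 22 of a vertex of the
-- tree rooted at (2, 1), and, since morphisms commute with Ū and V̄, the vertices of that tree
-- are exactly the images of (2, 1) under composites of φU : 2 ↦ 21, 1 ↦ 1 and
-- φV : 2 ↦ 2, 1 ↦ 21.  One inducts on these decompositions of (α, β) and (u, v).  When both
-- begin with the same morphism, θ^s is desubstituted (images of words starting with 2, resp.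
-- ending with 1, are recognisable) and the length hypothesis becomes a weighted one, which is
-- why the induction runs over all letter weights.  When they begin with different morphisms,
-- θ^s contains 22 or 11, which the other morphism never produces.  If θ becomes 2 (or 1) one
-- level down, the power 2^s is heavier than α and β and cannot straddle two blocks, so it
-- lies inside α or β, which is impossible unless α = 2 (resp. β = 1).
module Submission where

open import Defs
open import Data.Nat using (ℕ; zero; suc; _+_; _*_; _<_; _≤_; _⊔_; NonZero)
open import Data.Nat.Properties using (+-assoc; ≤-<-trans; <⇒≱; m≤m+n; m≤n+m; m≤n*m; m⊔n<o⇒m<o; m⊔n<o⇒n<o)
open import Data.List using (List; []; _∷_; _++_; length; concatMap)
open import Data.List.Properties using (++-assoc; ++-identityʳ; ++-cancelˡ; ∷-injectiveˡ; ∷-injectiveʳ; concatMap-++)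
open import Data.List.Relation.Unary.All using (All; []; _∷_)
open import Data.Bool using (Bool; true; false)
open import Data.Product using (_×_; _,_; ∃-syntax; proj₁; proj₂; map₂)
import Data.Product as Product
open import Data.Sum using (_⊎_; inj₁; inj₂)
import Data.Sum as Sum
open import Data.Empty using (⊥; ⊥-elim)
open import Relation.Nullary using (¬_)
open import Relation.Binary.PropositionalEquality using (_≡_; _≢_; refl; sym; trans; cong; subst; subst₂; module ≡-Reasoning)

Morphism : Set
Morphism = Letter → Word

concatMapᵖ : Morphism → Pair → Pair
concatMapᵖ φ = Product.map (concatMap φ) (concatMap φ)

_∈ᵖ_ : Word → Pair → Set
θ ∈ᵖ (u , v) = θ ≡ u ⊎ θ ≡ v

concatMap-pow : ∀ (φ : Morphism) θ s → concatMap φ (pow θ s) ≡ pow (concatMap φ θ) s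
concatMap-pow φ θ zero    = refl
concatMap-pow φ θ (suc s) =
  trans (concatMap-++ φ θ (pow θ s)) (cong (concatMap φ θ ++_) (concatMap-pow φ θ s))

concatMap-wordOver : ∀ (φ : Morphism) α β cs →
  concatMap φ (wordOver α β cs) ≡ wordOver (concatMap φ α) (concatMap φ β) cs
concatMap-wordOver φ α β []           = refl
concatMap-wordOver φ α β (true ∷ cs)  =
  trans (concatMap-++ φ α _) (cong (concatMap φ α ++_) (concatMap-wordOver φ α β cs))
concatMap-wordOver φ α β (false ∷ cs) =
  trans (concatMap-++ φ β _) (cong (concatMap φ β ++_) (concatMap-wordOver φ α β cs))

concatMapᵖ-Ubar : ∀ φ P → concatMapᵖ φ (Ubar P) ≡ Ubar (concatMapᵖ φ P)
concatMapᵖ-Ubar φ (u , v) = cong (_, concatMap φ v) (concatMap-++ φ u v)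

concatMapᵖ-Vbar : ∀ φ P → concatMapᵖ φ (Vbar P) ≡ Vbar (concatMapᵖ φ P)
concatMapᵖ-Vbar φ (u , v) = cong (concatMap φ u ,_) (concatMap-++ φ u v)

∈ᵖ-concatMap : ∀ φ {θ P} → θ ∈ᵖ P → concatMap φ θ ∈ᵖ concatMapᵖ φ P
∈ᵖ-concatMap φ = Sum.map (cong (concatMap φ)) (cong (concatMap φ))

∈ᵖ-concatMap⁻¹ : ∀ φ {θ} P → θ ∈ᵖ concatMapᵖ φ P → ∃[ θ' ] θ ≡ concatMap φ θ' × θ' ∈ᵖ P
∈ᵖ-concatMap⁻¹ φ (u , v) (inj₁ e) = u , e , inj₁ refl
∈ᵖ-concatMap⁻¹ φ (u , v) (inj₂ e) = v , e , inj₂ refl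

ChildOf-trans : ∀ {P Q R} → ChildOf P Q → ChildOf Q R → ChildOf P R
ChildOf-trans h here      = h
ChildOf-trans h (stepU k) = stepU (ChildOf-trans h k)
ChildOf-trans h (stepV k) = stepV (ChildOf-trans h k)

ChildOf-concatMap : ∀ φ {P Q} → ChildOf P Q → ChildOf (concatMapᵖ φ P) (concatMapᵖ φ Q)
ChildOf-concatMap φ here          = here
ChildOf-concatMap φ (stepU {q} h) =
  subst (ChildOf _) (sym (concatMapᵖ-Ubar φ q)) (stepU (ChildOf-concatMap φ h))
ChildOf-concatMap φ (stepV {q} h) =
  subst (ChildOf _) (sym (concatMapᵖ-Vbar φ q)) (stepV (ChildOf-concatMap φ h))

ChildOf-concatMap⁻¹ : ∀ φ {P Q} → ChildOf (concatMapᵖ φ P) Q →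
  ∃[ Q' ] ChildOf P Q' × Q ≡ concatMapᵖ φ Q'
ChildOf-concatMap⁻¹ φ {P} here = P , here , refl
ChildOf-concatMap⁻¹ φ (stepU h) with ChildOf-concatMap⁻¹ φ h
... | Q' , c , refl = Ubar Q' , stepU c , sym (concatMapᵖ-Ubar φ Q')
ChildOf-concatMap⁻¹ φ (stepV h) with ChildOf-concatMap⁻¹ φ h
... | Q' , c , refl = Vbar Q' , stepV c , sym (concatMapᵖ-Vbar φ Q')

Subword-[] : ∀ w → Subword [] w
Subword-[] w = [] , w , refl

Subword-∷ : ∀ {x w} c → Subword x w → Subword x (c ∷ w)
Subword-∷ c (p , q , e) = c ∷ p , q , cong (c ∷_) e

Subword-prefix : ∀ x y → Subword x (x ++ y)
Subword-prefix x y = [] , y , refl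

Subword-suffix : ∀ x y → Subword y (x ++ y)
Subword-suffix x y = x , [] , cong (x ++_) (++-identityʳ y)

Subword-trans : ∀ {x y w} → Subword x y → Subword y w → Subword x w
Subword-trans {x} (p , q , refl) (p' , q' , refl) = p' ++ p , q ++ q' , (begin
  (p' ++ p) ++ x ++ q ++ q'   ≡⟨ ++-assoc p' p _ ⟩
  p' ++ p ++ x ++ q ++ q'     ≡⟨ cong (λ t → p' ++ p ++ t) (++-assoc x q q') ⟨
  p' ++ p ++ (x ++ q) ++ q'   ≡⟨ cong (p' ++_) (++-assoc p (x ++ q) q') ⟨
  p' ++ (p ++ x ++ q) ++ q'   ∎)
  where open ≡-Reasoning

-- Weighted lengths

weight : ℕ → ℕ → Word → ℕ
weight p q []       = 0
weight p q (l2 ∷ w) = p + weight p q w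
weight p q (l1 ∷ w) = q + weight p q w

weight-++ : ∀ p q u w → weight p q (u ++ w) ≡ weight p q u + weight p q w
weight-++ p q []       w = refl
weight-++ p q (l2 ∷ u) w = trans (cong (p +_) (weight-++ p q u w)) (sym (+-assoc p _ _))
weight-++ p q (l1 ∷ u) w = trans (cong (q +_) (weight-++ p q u w)) (sym (+-assoc q _ _))

weight-mono : ∀ {p q x w} → Subword x w → weight p q x ≤ weight p q w
weight-mono {p} {q} {x} (P , Q , refl) = begin
  weight p q x                          ≤⟨ m≤m+n _ _ ⟩
  weight p q x + weight p q Q           ≡⟨ weight-++ p q x Q ⟨
  weight p q (x ++ Q)                   ≤⟨ m≤n+m _ _ ⟩
  weight p q P + weight p q (x ++ Q)    ≡⟨ weight-++ p q P (x ++ Q) ⟨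
  weight p q (P ++ x ++ Q)              ∎
  where open Data.Nat.Properties.≤-Reasoning

weight-length : ∀ w → weight 1 1 w ≡ length w
weight-length []       = refl
weight-length (l2 ∷ w) = cong suc (weight-length w)
weight-length (l1 ∷ w) = cong suc (weight-length w)

Lighter : ℕ → ℕ → Pair → Word → Set
Lighter p q (α , β) w = weight p q α < weight p q w × weight p q β < weight p q w

Lighter-concatMap⁻¹ : ∀ {p q p' q'} φ → (∀ w → weight p q (concatMap φ w) ≡ weight p' q' w) →
  ∀ A θ s → Lighter p q (concatMapᵖ φ A) (pow (concatMap φ θ) s) → Lighter p' q' A (pow θ s)
Lighter-concatMap⁻¹ {p} {q} φ weight-φ (α , β) θ s (lα , lβ) = pull α lα , pull β lβ
  where
  pull : ∀ x → weight p q (concatMap φ x) < weight p q (pow (concatMap φ θ) s) →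
         weight _ _ x < weight _ _ (pow θ s)
  pull x = subst₂ _<_ (weight-φ x)
    (trans (cong (weight p q) (sym (concatMap-pow φ θ s))) (weight-φ (pow θ s)))

-- The tree rooted at (2, 1)

two one : Word
two = l2 ∷ []
one = l1 ∷ []

StartsWith2 : Word → Set
StartsWith2 w = ∃[ r ] w ≡ l2 ∷ r

data EndsWith1 : Word → Set where
  [l1] : EndsWith1 one
  cons : ∀ c {w} → EndsWith1 w → EndsWith1 (c ∷ w)

StartsWith2-++ : ∀ {u} w → StartsWith2 u → StartsWith2 (u ++ w)
StartsWith2-++ w (r , refl) = r ++ w , refl

StartsWith2⇒≢l1∷ : ∀ {w t} → StartsWith2 w → w ≢ l1 ∷ t
StartsWith2⇒≢l1∷ (_ , refl) ()

EndsWith1-++ : ∀ u {w} → EndsWith1 w → EndsWith1 (u ++ w)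
EndsWith1-++ []      h = h
EndsWith1-++ (c ∷ u) h = cons c (EndsWith1-++ u h)

EndsWith1-suffix : ∀ P c m → EndsWith1 (P ++ c ∷ m) → EndsWith1 (c ∷ m)
EndsWith1-suffix []          c m h          = h
EndsWith1-suffix (_ ∷ [])    c m (cons _ h) = h
EndsWith1-suffix (_ ∷ d ∷ P) c m (cons _ h) = EndsWith1-suffix (d ∷ P) c m h

EndsWith1⇒¬two : ¬ EndsWith1 two
EndsWith1⇒¬two (cons _ ())

EndsWith1⇒¬All≡l2 : ∀ {w} → EndsWith1 w → ¬ All (_≡ l2) w
EndsWith1⇒¬All≡l2 [l1]       (() ∷ _)
EndsWith1⇒¬All≡l2 (cons _ h) (_ ∷ all) = EndsWith1⇒¬All≡l2 h all

StartsWith2-pow : ∀ {θ} → StartsWith2 θ → ∀ s → StartsWith2 (pow θ (suc s))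
StartsWith2-pow h s = StartsWith2-++ _ h

EndsWith1-pow : ∀ {θ} → EndsWith1 θ → ∀ s → EndsWith1 (pow θ (suc s))
EndsWith1-pow {θ} h zero    = subst EndsWith1 (sym (++-identityʳ θ)) h
EndsWith1-pow {θ} h (suc s) = EndsWith1-++ θ (EndsWith1-pow h s)

data Shape : Word → Set where
  is-two   : Shape two
  is-one   : Shape one
  is-mixed : ∀ {w} → StartsWith2 w → EndsWith1 w → Shape w

root-unmixed : ∀ {θ} → θ ∈ᵖ (two , one) → StartsWith2 θ → EndsWith1 θ → ⊥
root-unmixed (inj₁ refl) _  e = EndsWith1⇒¬two e
root-unmixed (inj₂ refl) sθ _ = StartsWith2⇒≢l1∷ sθ refl

Shape-++ : ∀ {u w} → StartsWith2 u → EndsWith1 w → Shape (u ++ w)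
Shape-++ {u} {w} su ew = is-mixed (StartsWith2-++ w su) (EndsWith1-++ u ew)

φU φV double : Morphism
φU l2 = l2 ∷ l1 ∷ []
φU l1 = l1 ∷ []
φV l2 = l2 ∷ []
φV l1 = l2 ∷ l1 ∷ []
double l2 = l2 ∷ l2 ∷ []
double l1 = l1 ∷ l1 ∷ []

weight-φU : ∀ p q w → weight p q (concatMap φU w) ≡ weight (p + q) q w
weight-φU p q []       = refl
weight-φU p q (l2 ∷ w) = trans (cong (λ t → p + (q + t)) (weight-φU p q w)) (sym (+-assoc p q _))
weight-φU p q (l1 ∷ w) = cong (q +_) (weight-φU p q w)

weight-φV : ∀ p q w → weight p q (concatMap φV w) ≡ weight p (p + q) w
weight-φV p q []       = refl
weight-φV p q (l2 ∷ w) = cong (p +_) (weight-φV p q w)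
weight-φV p q (l1 ∷ w) = trans (cong (λ t → p + (q + t)) (weight-φV p q w)) (sym (+-assoc p q _))

weight-double : ∀ p q w → weight p q (concatMap double w) ≡ weight (p + p) (q + q) w
weight-double p q []       = refl
weight-double p q (l2 ∷ w) = trans (cong (λ t → p + (p + t)) (weight-double p q w)) (sym (+-assoc p p _))
weight-double p q (l1 ∷ w) = trans (cong (λ t → q + (q + t)) (weight-double p q w)) (sym (+-assoc q q _))

data Morphic : Pair → Set where
  root : Morphic (two , one)
  viaU : ∀ {P} → Morphic P → Morphic (concatMapᵖ φU P)
  viaV : ∀ {P} → Morphic P → Morphic (concatMapᵖ φV P)

-- Ū (resp. V̄) applied at the leaves equals φU (resp. φV) applied at the root.
Morphic-Ubar : ∀ {Q} → Morphic Q → Morphic (Ubar Q)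
Morphic-Ubar root         = viaU root
Morphic-Ubar (viaU {P} h) = subst Morphic (concatMapᵖ-Ubar φU P) (viaU (Morphic-Ubar h))
Morphic-Ubar (viaV {P} h) = subst Morphic (concatMapᵖ-Ubar φV P) (viaV (Morphic-Ubar h))

Morphic-Vbar : ∀ {Q} → Morphic Q → Morphic (Vbar Q)
Morphic-Vbar root         = viaV root
Morphic-Vbar (viaU {P} h) = subst Morphic (concatMapᵖ-Vbar φU P) (viaU (Morphic-Vbar h))
Morphic-Vbar (viaV {P} h) = subst Morphic (concatMapᵖ-Vbar φV P) (viaV (Morphic-Vbar h))

childOf⇒morphic : ∀ {Q} → ChildOf (two , one) Q → Morphic Q
childOf⇒morphic here      = root
childOf⇒morphic (stepU h) = Morphic-Ubar (childOf⇒morphic h)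
childOf⇒morphic (stepV h) = Morphic-Vbar (childOf⇒morphic h)

morphic⇒childOf : ∀ {Q} → Morphic Q → ChildOf (two , one) Q
morphic⇒childOf root     = here
morphic⇒childOf (viaU h) = ChildOf-trans (stepU here) (ChildOf-concatMap φU (morphic⇒childOf h))
morphic⇒childOf (viaV h) = ChildOf-trans (stepV here) (ChildOf-concatMap φV (morphic⇒childOf h))

alphabet⇒double : ∀ {Q} → IsAlphabet Q → ∃[ Q' ] Morphic Q' × Q ≡ concatMapᵖ double Q'
alphabet⇒double h with ChildOf-concatMap⁻¹ double {two , one} h
... | Q' , c , e = Q' , childOf⇒morphic c , e

ChildOf-shape : ∀ {Q} → ChildOf (two , one) Q →
  StartsWith2 (proj₁ Q) × EndsWith1 (proj₂ Q) × Shape (proj₁ Q) × Shape (proj₂ Q)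
ChildOf-shape here = ([] , refl) , [l1] , is-two , is-one
ChildOf-shape (stepU h) with ChildOf-shape h
... | su , ev , _ , shv = StartsWith2-++ _ su , ev , Shape-++ su ev , shv
ChildOf-shape (stepV h) with ChildOf-shape h
... | su , ev , shu , _ = su , EndsWith1-++ _ ev , shu , Shape-++ su ev

member-shape : ∀ {U θ} → Morphic U → θ ∈ᵖ U → Shape θ
member-shape hU (inj₁ refl) = proj₁ (proj₂ (proj₂ (ChildOf-shape (morphic⇒childOf hU))))
member-shape hU (inj₂ refl) = proj₂ (proj₂ (proj₂ (ChildOf-shape (morphic⇒childOf hU))))

-- Recognizability

HeadPreserving : Morphism → Set
HeadPreserving φ = ∀ c → ∃[ t ] φ c ≡ c ∷ t

concatMap-prefix⁻¹ : ∀ {φ} → HeadPreserving φ → ∀ z {q} W →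
  concatMap φ z ++ q ≡ concatMap φ W → ∃[ Q ] z ++ Q ≡ W
concatMap-prefix⁻¹ hp []      W _ = W , refl
concatMap-prefix⁻¹ {φ} hp (c ∷ z) {q} W e = go W (trans (sym (++-assoc (φ c) (concatMap φ z) q)) e)
  where
  head : ∀ d x → φ d ++ x ≡ d ∷ (proj₁ (hp d) ++ x)
  head d x = cong (_++ x) (proj₂ (hp d))
  go : ∀ W → φ c ++ concatMap φ z ++ q ≡ concatMap φ W → ∃[ Q ] c ∷ z ++ Q ≡ W
  go []      e with trans (sym (head c _)) e
  ... | ()
  go (w ∷ W) e with ∷-injectiveˡ (trans (sym (head c _)) (trans e (head w _)))
  ... | refl = map₂ (cong (c ∷_)) (concatMap-prefix⁻¹ hp z W (++-cancelˡ (φ c) _ _ e))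

φU-head-preserving : HeadPreserving φU
φU-head-preserving l2 = l1 ∷ [] , refl
φU-head-preserving l1 = [] , refl

double-head-preserving : HeadPreserving double
double-head-preserving l2 = l2 ∷ [] , refl
double-head-preserving l1 = l1 ∷ [] , refl

Recognizable : Morphism → (Word → Set) → Set
Recognizable φ R = ∀ {z} W → R z → Subword (concatMap φ z) (concatMap φ W) → Subword z W

desubstitute : ∀ {φ R} → Recognizable φ R → ∀ θ α β cs → (∀ s → R (pow θ (suc s))) → ∀ s →
  Subword (pow (concatMap φ θ) s) (wordOver (concatMap φ α) (concatMap φ β) cs) →
  Subword (pow θ s) (wordOver α β cs)
desubstitute _ _ _ _ _ _ zero _ = Subword-[] _
desubstitute {φ} rec θ α β cs R-pow (suc s) sb = rec (wordOver α β cs) (R-pow s)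
  (subst₂ Subword (sym (concatMap-pow φ θ (suc s))) (sym (concatMap-wordOver φ α β cs)) sb)

φU-recognizable : Recognizable φU StartsWith2
φU-recognizable W (r , refl) (P , Q , e) = go P W e
  where
  go : ∀ P W → P ++ concatMap φU (l2 ∷ r) ++ Q ≡ concatMap φU W → Subword (l2 ∷ r) W
  go []          W        e  = [] , concatMap-prefix⁻¹ φU-head-preserving (l2 ∷ r) W e
  go (_ ∷ P)     []       ()
  go (_ ∷ P)     (l1 ∷ W) e  = Subword-∷ l1 (go P W (∷-injectiveʳ e))
  go (_ ∷ [])    (l2 ∷ W) ()
  go (_ ∷ _ ∷ P) (l2 ∷ W) e  = Subword-∷ l2 (go P W (∷-injectiveʳ (∷-injectiveʳ e)))

φV-image-≢l1∷ : ∀ W {t} → concatMap φV W ≢ l1 ∷ t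
φV-image-≢l1∷ []       ()
φV-image-≢l1∷ (l1 ∷ W) ()
φV-image-≢l1∷ (l2 ∷ W) ()

φV-StartsWith2 : ∀ {r} → EndsWith1 r → StartsWith2 (concatMap φV r)
φV-StartsWith2 [l1]            = l1 ∷ [] , refl
φV-StartsWith2 (cons l2 {r} _) = concatMap φV r , refl
φV-StartsWith2 (cons l1 {r} _) = l1 ∷ concatMap φV r , refl

φV-prefix⁻¹ : ∀ {z} q W → EndsWith1 z →
  concatMap φV z ++ q ≡ concatMap φV W → ∃[ Q ] z ++ Q ≡ W
φV-prefix⁻¹ q []       [l1]        ()
φV-prefix⁻¹ q (l1 ∷ W) [l1]        _ = W , refl
φV-prefix⁻¹ q (l2 ∷ W) [l1]        e = ⊥-elim (φV-image-≢l1∷ W (sym (∷-injectiveʳ e)))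
φV-prefix⁻¹ q []       (cons l1 _) ()
φV-prefix⁻¹ q []       (cons l2 _) ()
φV-prefix⁻¹ q (l2 ∷ W) (cons l2 h) e = map₂ (cong (l2 ∷_)) (φV-prefix⁻¹ q W h (∷-injectiveʳ e))
φV-prefix⁻¹ q (l1 ∷ W) (cons l1 h) e =
  map₂ (cong (l1 ∷_)) (φV-prefix⁻¹ q W h (∷-injectiveʳ (∷-injectiveʳ e)))
φV-prefix⁻¹ q (l1 ∷ W) (cons l2 h) e =
  ⊥-elim (StartsWith2⇒≢l1∷ (StartsWith2-++ q (φV-StartsWith2 h)) (∷-injectiveʳ e))
φV-prefix⁻¹ q (l2 ∷ W) (cons l1 h) e = ⊥-elim (φV-image-≢l1∷ W (sym (∷-injectiveʳ e)))

φV-recognizable : Recognizable φV EndsWith1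
φV-recognizable {z} W h (P , Q , e) = go P W e
  where
  go : ∀ P W → P ++ concatMap φV z ++ Q ≡ concatMap φV W → Subword z W
  go []          W        e  = [] , φV-prefix⁻¹ Q W h e
  go (_ ∷ P)     []       ()
  go (_ ∷ P)     (l2 ∷ W) e  = Subword-∷ l2 (go P W (∷-injectiveʳ e))
  go (_ ∷ [])    (l1 ∷ W) e  =
    ⊥-elim (StartsWith2⇒≢l1∷ (StartsWith2-++ Q (φV-StartsWith2 h)) (∷-injectiveʳ e))
  go (_ ∷ _ ∷ P) (l1 ∷ W) e  = Subword-∷ l1 (go P W (∷-injectiveʳ (∷-injectiveʳ e)))

double-misaligned⇒All≡ : ∀ c r q W →
  c ∷ (concatMap double r ++ q) ≡ concatMap double W → All (_≡ c) r
double-misaligned⇒All≡ c []       q W        e = []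
double-misaligned⇒All≡ c (_ ∷ r)  q []       ()
double-misaligned⇒All≡ c (l1 ∷ r) q (l2 ∷ W) ()
double-misaligned⇒All≡ c (l2 ∷ r) q (l1 ∷ W) ()
double-misaligned⇒All≡ c (l1 ∷ r) q (l1 ∷ W) e with ∷-injectiveˡ e
... | refl = refl ∷ double-misaligned⇒All≡ l1 r q W (∷-injectiveʳ (∷-injectiveʳ e))
double-misaligned⇒All≡ c (l2 ∷ r) q (l2 ∷ W) e with ∷-injectiveˡ e
... | refl = refl ∷ double-misaligned⇒All≡ l2 r q W (∷-injectiveʳ (∷-injectiveʳ e))

double-recognizable : Recognizable double (λ z → StartsWith2 z × EndsWith1 z)
double-recognizable W ((r , refl) , h) (P , Q , e) = go P W e
  where
  go : ∀ P W → P ++ concatMap double (l2 ∷ r) ++ Q ≡ concatMap double W → Subword (l2 ∷ r) W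
  go []          W        e  = [] , concatMap-prefix⁻¹ double-head-preserving (l2 ∷ r) W e
  go (_ ∷ P)     []       ()
  go (_ ∷ [])    (l1 ∷ W) ()
  go (_ ∷ [])    (l2 ∷ W) e  = ⊥-elim (EndsWith1⇒¬All≡l2 h
    (refl ∷ double-misaligned⇒All≡ l2 r Q W (∷-injectiveʳ (∷-injectiveʳ e))))
  go (_ ∷ _ ∷ P) (l1 ∷ W) e  = Subword-∷ l1 (go P W (∷-injectiveʳ (∷-injectiveʳ e)))
  go (_ ∷ _ ∷ P) (l2 ∷ W) e  = Subword-∷ l2 (go P W (∷-injectiveʳ (∷-injectiveʳ e)))

φU-image-22-free : ∀ W → ¬ Subword (l2 ∷ l2 ∷ []) (concatMap φU W)
φU-image-22-free W (P , Q , e) = go P W e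
  where
  go : ∀ P W → ¬ (P ++ l2 ∷ l2 ∷ Q ≡ concatMap φU W)
  go []          (l2 ∷ W) ()
  go []          (l1 ∷ W) ()
  go (_ ∷ P)     (l1 ∷ W) e = go P W (∷-injectiveʳ e)
  go (_ ∷ [])    (l2 ∷ W) ()
  go (_ ∷ _ ∷ P) (l2 ∷ W) e = go P W (∷-injectiveʳ (∷-injectiveʳ e))

φV-image-11-free : ∀ W → ¬ Subword (l1 ∷ l1 ∷ []) (concatMap φV W)
φV-image-11-free W (P , Q , e) = go P W e
  where
  go : ∀ P W → ¬ (P ++ l1 ∷ l1 ∷ Q ≡ concatMap φV W)
  go []          (l2 ∷ W)      ()
  go []          (l1 ∷ W)      ()
  go (_ ∷ P)     (l2 ∷ W)      e = go P W (∷-injectiveʳ e)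
  go (_ ∷ [])    (l1 ∷ W)      e = φV-image-≢l1∷ W (sym (∷-injectiveʳ (∷-injectiveʳ e)))
  go (_ ∷ _ ∷ P) (l1 ∷ W)      e = go P W (∷-injectiveʳ (∷-injectiveʳ e))

φU-image-has-11 : ∀ c {r} → EndsWith1 r → Subword (l1 ∷ l1 ∷ []) (concatMap φU (c ∷ r))
φU-image-has-11 l2 [l1]       = l2 ∷ [] , [] , refl
φU-image-has-11 l1 [l1]       = [] , [] , refl
φU-image-has-11 c  (cons d h) = Subword-trans (φU-image-has-11 d h) (Subword-suffix (φU c) _)

φV-image-has-22 : ∀ {r} → EndsWith1 r → Subword (l2 ∷ l2 ∷ []) (concatMap φV (l2 ∷ r))
φV-image-has-22 h with φV-StartsWith2 h
... | t , e = [] , t , cong (l2 ∷_) (sym e)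

-- Long runs of one letter

Subword-in-block : ∀ {R : Word → Set} {c x α β} →
  (∀ {B} cs → R B → Subword (c ∷ x) (B ++ wordOver α β cs) →
     Subword (c ∷ x) B ⊎ Subword (c ∷ x) (wordOver α β cs)) →
  R α → R β → ∀ cs → Subword (c ∷ x) (wordOver α β cs) → Subword (c ∷ x) α ⊎ Subword (c ∷ x) β
Subword-in-block step Rα Rβ []           ([] , _ , ())
Subword-in-block step Rα Rβ []           (_ ∷ _ , _ , ())
Subword-in-block step Rα Rβ (true ∷ cs)  sb with step cs Rα sb
... | inj₁ s = inj₁ s
... | inj₂ s = Subword-in-block step Rα Rβ cs s
Subword-in-block step Rα Rβ (false ∷ cs) sb with step cs Rβ sb
... | inj₁ s = inj₂ s
... | inj₂ s = Subword-in-block step Rα Rβ cs s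

++-split : ∀ (P x B R : Word) → P ++ x ≡ B ++ R →
  (∃[ P' ] P' ++ x ≡ R) ⊎ (∃[ c ] ∃[ m ] B ≡ P ++ c ∷ m × x ≡ c ∷ m ++ R)
++-split []      x []      R e = inj₁ ([] , e)
++-split []      x (c ∷ B) R e = inj₂ (c , B , refl , e)
++-split (c ∷ P) x []      R e = inj₁ (c ∷ P , e)
++-split (c ∷ P) x (d ∷ B) R e with ∷-injectiveˡ e | ++-split P x B R (∷-injectiveʳ e)
... | refl | inj₁ r                   = inj₁ r
... | refl | inj₂ (c' , m , eB , ex) = inj₂ (c' , m , cong (c ∷_) eB , ex)

Subword-++-split : ∀ {x B R} → Subword x (B ++ R) →
  (∀ {P c m Q} → B ≡ P ++ c ∷ m → x ++ Q ≡ c ∷ m ++ R → ∃[ Q' ] x ++ Q' ≡ c ∷ m) →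
  Subword x B ⊎ Subword x R
Subword-++-split {x} {B} {R} (P , Q , e) prefix with ++-split P (x ++ Q) B R e
... | inj₁ (P' , e')         = inj₂ (P' , Q , e')
... | inj₂ (c , m , refl , e') = inj₁ (P , map₂ (cong (P ++_)) (prefix refl e'))

two-run-prefix : ∀ n {Q m R} → EndsWith1 m → pow two n ++ Q ≡ m ++ R → ∃[ Q' ] pow two n ++ Q' ≡ m
two-run-prefix zero    {m = m} _ _ = m , refl
two-run-prefix (suc n) [l1]       ()
two-run-prefix (suc n) (cons c h) e with ∷-injectiveˡ e | two-run-prefix n h (∷-injectiveʳ e)
... | refl | Q' , e' = Q' , cong (l2 ∷_) e'

one-run-prefix : ∀ n {Q m R} → R ≡ [] ⊎ StartsWith2 R →
  pow one n ++ Q ≡ m ++ R → ∃[ Q' ] pow one n ++ Q' ≡ m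
one-run-prefix zero    {m = m}     _                  _ = m , refl
one-run-prefix (suc n) {m = []}    (inj₁ refl)        ()
one-run-prefix (suc n) {m = []}    (inj₂ (_ , refl)) ()
one-run-prefix (suc n) {m = c ∷ m} hR e with ∷-injectiveˡ e | one-run-prefix n hR (∷-injectiveʳ e)
... | refl | Q' , e' = Q' , cong (l1 ∷_) e'

wordOver-StartsWith2 : ∀ {α β} → StartsWith2 α → StartsWith2 β → ∀ cs →
  wordOver α β cs ≡ [] ⊎ StartsWith2 (wordOver α β cs)
wordOver-StartsWith2 sα sβ []           = inj₁ refl
wordOver-StartsWith2 sα sβ (true ∷ cs)  = inj₂ (StartsWith2-++ _ sα)
wordOver-StartsWith2 sα sβ (false ∷ cs) = inj₂ (StartsWith2-++ _ sβ)

two-run-in-block : ∀ {α β} n → EndsWith1 α → EndsWith1 β → ∀ cs →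
  Subword (pow two (suc n)) (wordOver α β cs) →
  Subword (pow two (suc n)) α ⊎ Subword (pow two (suc n)) β
two-run-in-block n = Subword-in-block λ _ eB sb →
  Subword-++-split sb λ {P} {c} {m} eq →
    two-run-prefix (suc n) (EndsWith1-suffix P c m (subst EndsWith1 eq eB))

one-run-in-block : ∀ {α β} n → StartsWith2 α → StartsWith2 β → ∀ cs →
  Subword (pow one (suc n)) (wordOver α β cs) →
  Subword (pow one (suc n)) α ⊎ Subword (pow one (suc n)) β
one-run-in-block n sα sβ = Subword-in-block (λ cs _ sb →
  Subword-++-split sb λ _ → one-run-prefix (suc n) (wordOver-StartsWith2 sα sβ cs)) sα sβ

two-power-factor : ∀ {α β p q} s cs → Morphic (α , β) → Lighter p q (α , β) (pow two s) →
  Subword (pow two s) (wordOver α β cs) → two ≡ α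
two-power-factor zero    _  _ (() , _) _
two-power-factor (suc n) cs hA (lα , lβ) sb with ChildOf-shape (morphic⇒childOf hA)
... | _       , _  , is-two       , _ = refl
... | (_ , ()) , _  , is-one       , _
... | _       , eβ , is-mixed _ eα , _ with two-run-in-block n eα eβ cs sb
...   | inj₁ sα = ⊥-elim (<⇒≱ lα (weight-mono sα))
...   | inj₂ sβ = ⊥-elim (<⇒≱ lβ (weight-mono sβ))

one-power-factor : ∀ {α β p q} s cs → Morphic (α , β) → Lighter p q (α , β) (pow one s) →
  Subword (pow one s) (wordOver α β cs) → one ≡ β
one-power-factor zero    _  _ (() , _) _
one-power-factor (suc n) cs hA (lα , lβ) sb with ChildOf-shape (morphic⇒childOf hA)
... | _  , eβ , _ , is-two       = ⊥-elim (EndsWith1⇒¬two eβ)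
... | _  , _  , _ , is-one       = refl
... | sα , _  , _ , is-mixed sβ _ with one-run-in-block n sα sβ cs sb
...   | inj₁ sα' = ⊥-elim (<⇒≱ lα (weight-mono sα'))
...   | inj₂ sβ' = ⊥-elim (<⇒≱ lβ (weight-mono sβ'))

descend-φU : ∀ {p q} α β θ cs s → StartsWith2 θ →
  Lighter p q (concatMapᵖ φU (α , β)) (pow (concatMap φU θ) s) →
  Subword (pow (concatMap φU θ) s) (wordOver (concatMap φU α) (concatMap φU β) cs) →
  Lighter (p + q) q (α , β) (pow θ s) × Subword (pow θ s) (wordOver α β cs)
descend-φU {p} {q} α β θ cs s sθ light sb =
  Lighter-concatMap⁻¹ φU (weight-φU p q) (α , β) θ s light ,
  desubstitute φU-recognizable θ α β cs (StartsWith2-pow sθ) s sb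

descend-φV : ∀ {p q} α β θ cs s → EndsWith1 θ →
  Lighter p q (concatMapᵖ φV (α , β)) (pow (concatMap φV θ) s) →
  Subword (pow (concatMap φV θ) s) (wordOver (concatMap φV α) (concatMap φV β) cs) →
  Lighter p (p + q) (α , β) (pow θ s) × Subword (pow θ s) (wordOver α β cs)
descend-φV {p} {q} α β θ cs s eθ light sb =
  Lighter-concatMap⁻¹ φV (weight-φV p q) (α , β) θ s light ,
  desubstitute φV-recognizable θ α β cs (EndsWith1-pow eθ) s sb

Subword-power-factor : ∀ φ α β cs s {x θ} → Subword x θ →
  Subword (pow θ (suc s)) (wordOver (concatMap φ α) (concatMap φ β) cs) →
  Subword x (concatMap φ (wordOver α β cs))
Subword-power-factor φ α β cs s {θ = θ} x⊆θ sb =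
  Subword-trans x⊆θ (Subword-trans (Subword-prefix θ (pow θ s))
    (subst (Subword _) (sym (concatMap-wordOver φ α β cs)) sb))

-- θ = 21 is both φU 2 and φV 1; any other θ of the form φV θ' (resp. φU θ') contains 22
-- (resp. 11), which never occurs in an image of φU (resp. φV).
φU-φV-case : ∀ {α β U θ p q} s cs → Morphic (α , β) → Morphic U → θ ∈ᵖ concatMapᵖ φV U →
  EndsWith1 θ → Lighter p q (concatMapᵖ φU (α , β)) (pow θ s) →
  Subword (pow θ s) (wordOver (concatMap φU α) (concatMap φU β) cs) → θ ≡ concatMap φU α
φU-φV-case zero _ _ _ _ _ (() , _) _
φU-φV-case {α} {β} {U} (suc s) cs hA hU θ∈ eθ light sb with ∈ᵖ-concatMap⁻¹ φV U θ∈
... | θ' , refl , θ'∈ with member-shape hU θ'∈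
...   | is-two = ⊥-elim (EndsWith1⇒¬two eθ)
...   | is-one =
  let light' , sb' = descend-φU α β two cs (suc s) ([] , refl) light sb
  in cong (concatMap φU) (two-power-factor (suc s) cs hA light' sb')
...   | is-mixed (_ , refl) (cons _ h) =
  ⊥-elim (φU-image-22-free (wordOver α β cs)
    (Subword-power-factor φU α β cs s (φV-image-has-22 h) sb))

φV-φU-case : ∀ {α β U θ p q} s cs → Morphic (α , β) → Morphic U → θ ∈ᵖ concatMapᵖ φU U →
  StartsWith2 θ → Lighter p q (concatMapᵖ φV (α , β)) (pow θ s) →
  Subword (pow θ s) (wordOver (concatMap φV α) (concatMap φV β) cs) → θ ≡ concatMap φV β
φV-φU-case zero _ _ _ _ _ (() , _) _
φV-φU-case {α} {β} {U} (suc s) cs hA hU θ∈ sθ light sb with ∈ᵖ-concatMap⁻¹ φU U θ∈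
... | θ' , refl , θ'∈ with member-shape hU θ'∈
...   | is-one = ⊥-elim (StartsWith2⇒≢l1∷ sθ refl)
...   | is-two =
  let light' , sb' = descend-φV α β one cs (suc s) [l1] light sb
  in cong (concatMap φV) (one-power-factor (suc s) cs hA light' sb')
...   | is-mixed (_ , refl) (cons c h) =
  ⊥-elim (φV-image-11-free (wordOver α β cs)
    (Subword-power-factor φV α β cs s (φU-image-has-11 c h) sb))

lemma2p15-morphic : ∀ {α β U θ} p q s cs → Morphic (α , β) → Morphic U → θ ∈ᵖ U →
  StartsWith2 θ → EndsWith1 θ → Lighter p q (α , β) (pow θ s) →
  Subword (pow θ s) (wordOver α β cs) → θ ∈ᵖ (α , β) ⊎ ChildOf (α , β) U
lemma2p15-morphic p q zero    cs _    _  _ _ _ (() , _) _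
lemma2p15-morphic p q (suc s) cs root hU _ _ _ _        _ = inj₂ (morphic⇒childOf hU)
lemma2p15-morphic p q (suc s) cs (viaU _) root θ∈ sθ eθ _ _ = ⊥-elim (root-unmixed θ∈ sθ eθ)
lemma2p15-morphic p q (suc s) cs (viaV _) root θ∈ sθ eθ _ _ = ⊥-elim (root-unmixed θ∈ sθ eθ)
lemma2p15-morphic p q (suc s) cs (viaU {α , β} hA) (viaU {U} hU) θ∈ sθ eθ light sb
  with ∈ᵖ-concatMap⁻¹ φU U θ∈
... | θ' , refl , θ'∈ with member-shape hU θ'∈
...   | is-one = ⊥-elim (StartsWith2⇒≢l1∷ sθ refl)
...   | is-two =
  let light' , sb' = descend-φU α β two cs (suc s) ([] , refl) light sb
  in inj₁ (inj₁ (cong (concatMap φU) (two-power-factor (suc s) cs hA light' sb')))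
...   | is-mixed sθ' eθ' =
  let light' , sb' = descend-φU α β θ' cs (suc s) sθ' light sb
  in Sum.map (∈ᵖ-concatMap φU) (ChildOf-concatMap φU)
       (lemma2p15-morphic (p + q) q (suc s) cs hA hU θ'∈ sθ' eθ' light' sb')
lemma2p15-morphic p q (suc s) cs (viaV {α , β} hA) (viaV {U} hU) θ∈ sθ eθ light sb
  with ∈ᵖ-concatMap⁻¹ φV U θ∈
... | θ' , refl , θ'∈ with member-shape hU θ'∈
...   | is-two = ⊥-elim (EndsWith1⇒¬two eθ)
...   | is-one =
  let light' , sb' = descend-φV α β one cs (suc s) [l1] light sb
  in inj₁ (inj₂ (cong (concatMap φV) (one-power-factor (suc s) cs hA light' sb')))
...   | is-mixed sθ' eθ' =
  let light' , sb' = descend-φV α β θ' cs (suc s) eθ' light sb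
  in Sum.map (∈ᵖ-concatMap φV) (ChildOf-concatMap φV)
       (lemma2p15-morphic p (p + q) (suc s) cs hA hU θ'∈ sθ' eθ' light' sb')
lemma2p15-morphic p q (suc s) cs (viaU hA) (viaV hU) θ∈ _ eθ light sb =
  inj₁ (inj₁ (φU-φV-case (suc s) cs hA hU θ∈ eθ light sb))
lemma2p15-morphic p q (suc s) cs (viaV hA) (viaU hU) θ∈ sθ _ light sb =
  inj₁ (inj₂ (φV-φU-case (suc s) cs hA hU θ∈ sθ light sb))

length-bound⇒Lighter : ∀ α β w →
  2 * (length (concatMap double α) ⊔ length (concatMap double β)) < length (concatMap double w) →
  Lighter 2 2 (α , β) w
length-bound⇒Lighter α β w long = shrink α (m⊔n<o⇒m<o _ _ M<L) , shrink β (m⊔n<o⇒n<o _ _ M<L)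
  where
  M<L = ≤-<-trans (m≤n*m _ 2) long
  length-double : ∀ x → length (concatMap double x) ≡ weight 2 2 x
  length-double x = trans (sym (weight-length (concatMap double x))) (weight-double 1 1 x)
  shrink : ∀ x → length (concatMap double x) < length (concatMap double w) → weight 2 2 x < weight 2 2 w
  shrink x = subst₂ _<_ (length-double x) (length-double w)

lemma2p15 : ∀ (u v θ α β : Word) → IsAlphabet (u , v)
    → (θ ≡ u ⊎ θ ≡ v) → ¬ (θ ≡ a) → ¬ (θ ≡ b)
    → IsAlphabet (α , β)
    → (s : ℕ) → NonZero s → 2 * (length α ⊔ length β) < length (pow θ s)
    → (cs : List Bool) → Subword (pow θ s) (wordOver α β cs)
    → (θ ≡ α ⊎ θ ≡ β) ⊎ ChildOf (α , β) (u , v)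
lemma2p15 u v θ α β uv-alphabet θ∈uv θ≢a θ≢b αβ-alphabet s _ long cs θˢ-factor
  with alphabet⇒double uv-alphabet | alphabet⇒double αβ-alphabet
... | U , hU , refl | (α' , β') , hA , refl with ∈ᵖ-concatMap⁻¹ double U θ∈uv
... | θ' , refl , θ'∈U with member-shape hU θ'∈U
... | is-two = ⊥-elim (θ≢a refl)
... | is-one = ⊥-elim (θ≢b refl)
... | is-mixed sθ eθ =
  Sum.map (∈ᵖ-concatMap double) (ChildOf-concatMap double)
    (lemma2p15-morphic 2 2 s cs hA hU θ'∈U sθ eθ
      (length-bound⇒Lighter α' β' (pow θ' s)
        (subst (λ w → _ < length w) (sym (concatMap-pow double θ' s)) long))
      (desubstitute double-recognizable θ' α' β' cs
        (λ n → StartsWith2-pow sθ n , EndsWith1-pow eθ n) s θˢ-factor))
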